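{- Let $\mathcal{F}\subseteq\mathcal{B}^{<\omega}(\mathbb{N})$. (i) If $\mathcal{F}$ is a tree, then $\mathcal{F}$ is pointwise closed if and only if $\mathcal{F}$ contains no infinite sequence $(\mathbf{s}_n)_{n\in\mathbb{N}}$ with $\mathbf{s}_1\propto\mathbf{s}_2\propto\cdots$ and $\mathbf{s}_n\neq\mathbf{s}_{n+1}$ for all $n$. (ii) If $\mathcal{F}$ is hereditary, then $\mathcal{F}$ is pointwise closed if and only if there is no infinite disjoint collection $\mathcal{D}$ with $\mathcal{B}^{<\omega}(\mathcal{D})\subseteq\mathcal{F}$.
   Context: $\mathbb{N}=\{1,2,\dots\}$. For nonempty $s,t\subseteq\mathbb{N}$ with $s$ finite, $s<t$ means $\max s<\min t$. A finite disjoint collection is a tuple $(s_1,\dots,s_k)$, $k\ge0$ ($\emptyset$ for $k=0$), of nonempty finite subsets of $\mathbb{N}$ with $s_1<\dots<s_k$; an infinite disjoint collection is a sequence $(s_n)$ of nonempty finite subsets with $s_n<s_{n+1}$; collections are identified with the set of their members. $\mathcal{B}^{<\omega}(\mathbb{N})$: all finite disjoint collections. $FU(\mathcal{D})$: unions of finitely many (at least one) members of $\mathcal{D}$; $\mathcal{B}^{<\omega}(\mathcal{D})$: finite disjoint collections with all members in $FU(\mathcal{D})$. $\mathbf{t}\propto\mathbf{s}$: $\mathbf{t}$ is an initial segment of $\mathbf{s}$. $\mathcal{F}^*=\{\mathbf{t}:\mathbf{t}\propto\mathbf{s}\text{ for some }\mathbf{s}\in\mathcal{F}\}\cup\{\emptyset\}$,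 tree means $\mathcal{F}^*=\mathcal{F}$; $\mathcal{F}_*=\{\mathbf{t}\in\mathcal{B}^{<\omega}(\mathbb{N}):\mathbf{t}\subseteq FU(\mathbf{s})\text{ for some }\mathbf{s}\in\mathcal{F}\}\cup\{\emptyset\}$, hereditary means $\mathcal{F}_*=\mathcal{F}$. Pointwise closed: identify each collection of finite subsets of $\mathbb{N}$ with its characteristic function in $\{0,1\}^{[\mathbb{N}]^{<\omega}}$; $\mathcal{F}$ is pointwise closed if $\{x_{\mathbf{s}}:\mathbf{s}\in\mathcal{F}\}$ is closed in the product topology. -}

module Defs where

open import Data.Nat using (ℕ; suc; _<_; _≤_)
open import Data.Bool using (Bool; true)
open import Data.List using (List; []; _∷_; _++_)
open import Data.List.Relation.Unary.All using (All)
open import Data.List.Relation.Unary.Any using (Any)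
open import Data.List.Relation.Unary.AllPairs using (AllPairs)
open import Data.List.Membership.Propositional using (_∈_)
open import Data.Product using (Σ; ∃; _×_)
open import Data.Sum using (_⊎_)
open import Relation.Binary.PropositionalEquality using (_≡_; _≢_)
open import Relation.Nullary using (¬_)
open import Function using (_⇔_)

-- A finite subset of ℕ = {1,2,...} is represented canonically by the
-- strictly increasing list of its elements, all ≥ 1.
FinSub : List ℕ → Set
FinSub u = AllPairs _<_ u × All (1 ≤_) u

NEFinSub : List ℕ → Set
NEFinSub u = FinSub u × u ≢ []

_≺_ : List ℕ → List ℕ → Set
s ≺ t = All (λ x → All (λ y → x < y) t) s

-- finite disjoint collection (s₁,…,s_k), s₁ < … < s_k  (member of B^{<ω}(ℕ))
IsDC : List (List ℕ) → Set
IsDC c = All NEFinSub c × AllPairs _≺_ c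

IsInfDC : (ℕ → List ℕ) → Set
IsInfDC D = (∀ n → NEFinSub (D n)) × (∀ n → D n ≺ D (suc n))

InFU : (List ℕ → Set) → List ℕ → Set
InFU M u = Σ (List (List ℕ)) λ ms →
  (ms ≢ []) × All M ms × (∀ x → (x ∈ u) ⇔ Any (x ∈_) ms)

MemSeq : (ℕ → List ℕ) → List ℕ → Set
MemSeq D m = ∃ λ n → D n ≡ m

_∝_ : List (List ℕ) → List (List ℕ) → Set
t ∝ s = ∃ λ u → t ++ u ≡ s

Family : Set₁
Family = List (List ℕ) → Set

Star : Family → Family
Star F t = (∃ λ s → F s × t ∝ s) ⊎ t ≡ []

LowStar : Family → Family
LowStar F t = (IsDC t × ∃ λ s → F s × All (InFU (_∈ s)) t) ⊎ t ≡ []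

IsTree : Family → Set
IsTree F = ∀ t → Star F t ⇔ F t

IsHereditary : Family → Set
IsHereditary F = ∀ t → LowStar F t ⇔ F t

Agrees : (List ℕ → Bool) → List (List ℕ) → List ℕ → Set
Agrees X s u = (X u ≡ true) ⇔ (u ∈ s)

-- X ∈ {0,1}^{[ℕ]^{<ω}} lies in the product-topology closure of {x_s : s ∈ F}:
-- every basic neighbourhood (fixing finitely many coordinates) meets it.
InClosure : Family → (List ℕ → Bool) → Set
InClosure F X = ∀ (us : List (List ℕ)) → All FinSub us →
  ∃ λ s → F s × All (Agrees X s) us

PointwiseClosed : Family → Set
PointwiseClosed F = ∀ (X : List ℕ → Bool) → InClosure F X →
  ∃ λ s → F s × (∀ u → FinSub u → Agrees X s u)

HasInfChain : Family → Set
HasInfChain F = ∃ λ (S : ℕ → List (List ℕ)) →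
  (∀ n → F (S n)) × (∀ n → S n ∝ S (suc n)) × (∀ n → S n ≢ S (suc n))

BSubset : (ℕ → List ℕ) → Family → Set
BSubset D F = ∀ t → IsDC t → All (InFU (MemSeq D)) t → F t

{-# OPTIONS --safe #-}
module Submission where

-- (i) If s₁ ∝ s₂ ∝ ⋯ is a strictly increasing chain in F, the characteristic
-- function of ⋃ₙ sₙ lies in the closure of F, as finitely many coordinates are
-- decided by a single sₙ. It is no x_s: s would be contained in some s_N, and
-- then a set added after stage N would lie in s ⊆ s_N, hence ≺-below itself.
-- Conversely let X lie in the closure of a tree F. Testing X against F on one
-- or two coordinates shows that the sets marked by X are nonempty and pairwise
-- ≺-comparable. If t ∈ F lists the marked sets below some point in order and u
-- is the ≺-least marked set outside t, testing on u and on all finite sets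
-- below min u yields some s ∈ F of which t ++ [u] is an initial segment. So if
-- X is no x_s, the marked sets give an infinite strictly increasing chain in F.
-- (ii) A hereditary F is a tree, and the chains in it correspond to the
-- infinite disjoint collections D with B(D) ⊆ F: the sets added along a chain
-- form such a D, and the initial segments of such a D form a chain.

open import Defs
open import Level using (0ℓ)
open import Axiom.ExcludedMiddle using (ExcludedMiddle)
open import Data.Nat using (ℕ; zero; suc; _+_; _<_; _≤_; _≤′_; ≤′-refl; ≤′-step; _⊔_; _≟_; _<?_; _≤?_; z≤n)
open import Data.Nat.Properties using (<-irrefl; <-trans; ≤⇒≯; ≮⇒≥; ≤∧≢⇒<; ≤⇒≤′; m≤m⊔n; m≤n⊔m; +-identityʳ; +-suc)
open import Data.Nat.Induction using (<-rec)
open import Data.Bool using (Bool; true)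
open import Data.List using (List; []; _∷_; _++_; [_]; map; filter)
open import Data.List.Properties using (++-assoc; ++-identityʳ; ++-identityʳ-unique; ≡-dec)
open import Data.List.Relation.Unary.All as All using (All; []; _∷_)
import Data.List.Relation.Unary.All.Properties as All
open import Data.List.Relation.Unary.Any using (here; there)
open import Data.List.Relation.Unary.Any.Properties using (singleton⁻)
open import Data.List.Relation.Unary.AllPairs as AllPairs using (AllPairs; []; _∷_)
import Data.List.Relation.Unary.AllPairs.Properties as AllPairs
open import Data.List.Relation.Binary.Sublist.Propositional using (_⊆_; []; _∷_; _∷ʳ_; minimum)
open import Data.List.Membership.Propositional using (_∈_; _∉_)
open import Data.List.Membership.Propositional.Properties using (∈-∃++; ∈-++⁺ˡ; ∈-++⁺ʳ; ∈-++⁻; ∈-map⁺; ∈-filter⁺)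
open import Data.List.Membership.DecPropositional (≡-dec _≟_) using (_∈?_)
open import Data.Product using (Σ; ∃; ∃₂; _×_; _,_; proj₁; proj₂)
open import Data.Sum using (_⊎_; inj₁; inj₂)
open import Data.Empty using (⊥-elim)
open import Relation.Nullary using (¬_; yes; no; does)
open import Relation.Nullary.Decidable using (_×-dec_; decidable-stable)
open import Relation.Unary using (Decidable)
open import Relation.Binary using (Rel)
open import Relation.Binary.PropositionalEquality using (_≡_; _≢_; refl; sym; cong; subst; module ≡-Reasoning)
open import Function using (_∘_; _⇔_; mk⇔; Equivalence)
open Equivalence using (to; from)
import Function.Properties.Equivalence as ⇔

module _ {a ℓ} {A : Set a} {R : Rel A ℓ} where

  AllPairs-compare : ∀ {xs x y} → AllPairs R xs → x ∈ xs → y ∈ xs → x ≡ y ⊎ R x y ⊎ R y x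
  AllPairs-compare (_ ∷ _) (here refl) (here refl) = inj₁ refl
  AllPairs-compare (Rx ∷ _) (here refl) (there y∈) = inj₂ (inj₁ (All.lookup Rx y∈))
  AllPairs-compare (Ry ∷ _) (there x∈) (here refl) = inj₂ (inj₂ (All.lookup Ry x∈))
  AllPairs-compare (_ ∷ Rxs) (there x∈) (there y∈) = AllPairs-compare Rxs x∈ y∈

  AllPairs-++⁻ˡ : ∀ xs {ys} → AllPairs R (xs ++ ys) → AllPairs R xs
  AllPairs-++⁻ˡ [] _ = []
  AllPairs-++⁻ˡ (x ∷ xs) (Rx ∷ Rxs) = All.++⁻ˡ xs Rx ∷ AllPairs-++⁻ˡ xs Rxs

  AllPairs-earlier : ∀ xs {y ys x} → AllPairs R (xs ++ y ∷ ys) → x ∈ xs → R x y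
  AllPairs-earlier (_ ∷ xs) (Rx ∷ _) (here refl) = All.lookup Rx (∈-++⁺ʳ xs (here refl))
  AllPairs-earlier (_ ∷ xs) (_ ∷ Rxs) (there x∈) = AllPairs-earlier xs Rxs x∈

  AllPairs-later : ∀ xs {y ys z} → AllPairs R (xs ++ y ∷ ys) → z ∈ ys → R y z
  AllPairs-later [] (Ry ∷ _) z∈ = All.lookup Ry z∈
  AllPairs-later (_ ∷ xs) (_ ∷ Rxs) z∈ = AllPairs-later xs Rxs z∈

snoc-≢ : ∀ {a} {A : Set a} (xs : List A) {x} → xs ≢ xs ++ [ x ]
snoc-≢ xs eq with () ← ++-identityʳ-unique xs eq

common-bound : ∀ {a p} {A : Set a} (P : A → ℕ → Set p) → (∀ {x m n} → m ≤ n → P x m → P x n) →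
               ∀ {xs} → All (λ x → ∃ (P x)) xs → ∃ λ N → All (λ x → P x N) xs
common-bound P mono [] = 0 , []
common-bound P mono ((n , p) ∷ ps) with common-bound P mono ps
... | N , qs = n ⊔ N , mono (m≤m⊔n n N) p ∷ All.map (mono (m≤n⊔m n N)) qs

least-number : ExcludedMiddle 0ℓ → (P : ℕ → Set) → ∀ {n} → P n → ∃ λ m → P m × (∀ {k} → P k → m ≤ k)
least-number lem P = <-rec (λ n → P n → Least) step _
  where
  Least : Set
  Least = ∃ λ m → P m × (∀ {k} → P k → m ≤ k)
  step : ∀ n → (∀ {k} → k < n → P k → Least) → P n → Least
  step n rec Pn with lem {∃ λ k → k < n × P k}
  ... | yes (k , k<n , Pk) = rec k<n Pk
  ... | no none = n , Pn , λ {k} Pk → ≮⇒≥ (λ k<n → none (k , k<n , Pk))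

sublists : ∀ {a} {A : Set a} → List A → List (List A)
sublists [] = [ [] ]
sublists (x ∷ xs) = sublists xs ++ map (x ∷_) (sublists xs)

⊆⇒∈-sublists : ∀ {a} {A : Set a} {xs ys : List A} → ys ⊆ xs → ys ∈ sublists xs
⊆⇒∈-sublists [] = here refl
⊆⇒∈-sublists (x ∷ʳ ys⊆xs) = ∈-++⁺ˡ (⊆⇒∈-sublists ys⊆xs)
⊆⇒∈-sublists (refl ∷ ys⊆xs) = ∈-++⁺ʳ _ (∈-map⁺ _ (⊆⇒∈-sublists ys⊆xs))

interval : ℕ → ℕ → List ℕ
interval k zero = []
interval k (suc n) = k ∷ interval (suc k) n

increasing⇒⊆-interval : ∀ k n {w} → AllPairs _<_ w → All (k ≤_) w → All (_< k + n) w → w ⊆ interval k n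
increasing⇒⊆-interval k zero {[]} _ _ _ = []
increasing⇒⊆-interval k zero {x ∷ _} _ (k≤x ∷ _) (x<k+0 ∷ _) =
  ⊥-elim (≤⇒≯ k≤x (subst (x <_) (+-identityʳ k) x<k+0))
increasing⇒⊆-interval k (suc n) {[]} _ _ _ = minimum _
increasing⇒⊆-interval k (suc n) {x ∷ w} (x<w ∷ w↑) (k≤x ∷ _) x∷w<k+1+n
  with k ≟ x | All.map (λ {y} → subst (y <_) (+-suc k n)) x∷w<k+1+n
... | yes refl | _ ∷ w<1+k+n = refl ∷ increasing⇒⊆-interval (suc k) n w↑ x<w w<1+k+n
... | no k≢x | x∷w<1+k+n =
  k ∷ʳ increasing⇒⊆-interval (suc k) n (x<w ∷ w↑) (k<x ∷ All.map (<-trans k<x) x<w) x∷w<1+k+n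
  where
  k<x : k < x
  k<x = ≤∧≢⇒< k≤x k≢x

FinSub? : Decidable FinSub
FinSub? u = AllPairs.allPairs? _<?_ u ×-dec All.all? (1 ≤?_) u

finSubsBelow : ℕ → List (List ℕ)
finSubsBelow m = filter FinSub? (sublists (interval 0 m))

finSubsBelow-FinSub : ∀ m → All FinSub (finSubsBelow m)
finSubsBelow-FinSub m = All.all-filter FinSub? (sublists (interval 0 m))

finSubsBelow-complete : ∀ {m w} → FinSub w → All (_< m) w → w ∈ finSubsBelow m
finSubsBelow-complete {m} fw@(w↑ , _) w<m =
  ∈-filter⁺ FinSub? (⊆⇒∈-sublists (increasing⇒⊆-interval 0 m w↑ (All.tabulate (λ _ → z≤n)) w<m)) fw

≺-irrefl : ∀ {u} → u ≢ [] → ¬ u ≺ u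
≺-irrefl {[]} u≢[] _ = u≢[] refl
≺-irrefl {x ∷ _} _ ((x<x ∷ _) ∷ _) = <-irrefl refl x<x

≺-trans : ∀ {u v w} → v ≢ [] → u ≺ v → v ≺ w → u ≺ w
≺-trans {v = []} v≢[] _ _ = ⊥-elim (v≢[] refl)
≺-trans {v = y ∷ _} _ u≺v (y<w ∷ _) = All.map (λ x<v → All.map (<-trans (All.head x<v)) y<w) u≺v

≺-asym : ∀ {u v} → u ≢ [] → v ≢ [] → u ≺ v → ¬ v ≺ u
≺-asym u≢[] v≢[] u≺v v≺u = ≺-irrefl u≢[] (≺-trans v≢[] u≺v v≺u)

≺⇒<-head : ∀ {u m r} → u ≺ (m ∷ r) → All (_< m) u
≺⇒<-head = All.map All.head

IsDC-member : ∀ {c w} → IsDC c → w ∈ c → NEFinSub w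
IsDC-member (ne , _) = All.lookup ne

IsDC-++⁻ˡ : ∀ xs {ys} → IsDC (xs ++ ys) → IsDC xs
IsDC-++⁻ˡ xs (ne , ≺s) = All.++⁻ˡ xs ne , AllPairs-++⁻ˡ xs ≺s

IsDC-head-≡ : ∀ {x xs y ys} → IsDC (x ∷ xs) → IsDC (y ∷ ys) → x ∈ y ∷ ys → y ∈ x ∷ xs → x ≡ y
IsDC-head-≡ _ _ (here x≡y) _ = x≡y
IsDC-head-≡ _ _ (there _) (here y≡x) = sym y≡x
IsDC-head-≡ ((_ , x≢[]) ∷ _ , x≺xs ∷ _) ((_ , y≢[]) ∷ _ , y≺ys ∷ _) (there x∈ys) (there y∈xs) =
  ⊥-elim (≺-asym x≢[] y≢[] (All.lookup x≺xs y∈xs) (All.lookup y≺ys x∈ys))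

IsDC-≡ : ∀ {xs ys} → IsDC xs → IsDC ys →
         (∀ {w} → w ∈ xs → w ∈ ys) → (∀ {w} → w ∈ ys → w ∈ xs) → xs ≡ ys
IsDC-≡ {[]} {[]} _ _ _ _ = refl
IsDC-≡ {[]} {_ ∷ _} _ _ _ ys⊆xs with () ← ys⊆xs (here refl)
IsDC-≡ {_ ∷ _} {[]} _ _ xs⊆ys _ with () ← xs⊆ys (here refl)
IsDC-≡ {x ∷ xs} {y ∷ ys} dc-xs dc-ys xs⊆ys ys⊆xs
  with refl ← IsDC-head-≡ dc-xs dc-ys (xs⊆ys (here refl)) (ys⊆xs (here refl))
  with ((_ , x≢[]) ∷ ne-xs , x≺xs ∷ ≺xs) ← dc-xs | (_ ∷ ne-ys , x≺ys ∷ ≺ys) ← dc-ys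
  = cong (x ∷_) (IsDC-≡ (ne-xs , ≺xs) (ne-ys , ≺ys) (tail x≺xs xs⊆ys) (tail x≺ys ys⊆xs))
  where
  tail : ∀ {zs zs′} → All (x ≺_) zs → (∀ {w} → w ∈ x ∷ zs → w ∈ x ∷ zs′) → ∀ {w} → w ∈ zs → w ∈ zs′
  tail x≺zs zs⊆ w∈zs with zs⊆ (there w∈zs)
  ... | here refl = ⊥-elim (≺-irrefl x≢[] (All.lookup x≺zs w∈zs))
  ... | there w∈zs′ = w∈zs′

∝-refl : ∀ {t} → t ∝ t
∝-refl {t} = [] , ++-identityʳ t

∝-trans : ∀ {t s r} → t ∝ s → s ∝ r → t ∝ r
∝-trans {t} (a , refl) (b , refl) = a ++ b , sym (++-assoc t a b)

∝-∈ : ∀ {t s w} → t ∝ s → w ∈ t → w ∈ s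
∝-∈ (_ , refl) = ∈-++⁺ˡ

∝-≢⇒∃-next : ∀ {t s} → t ∝ s → t ≢ s → ∃₂ λ w a → t ++ w ∷ a ≡ s
∝-≢⇒∃-next {t} ([] , refl) t≢s = ⊥-elim (t≢s (sym (++-identityʳ t)))
∝-≢⇒∃-next (w ∷ a , t++w∷a≡s) _ = w , a , t++w∷a≡s

∈⇒InFU : ∀ {M w} → M w → InFU M w
∈⇒InFU {w = w} Mw = [ w ] , (λ ()) , Mw ∷ [] , λ _ → mk⇔ here singleton⁻

InFU-mono : ∀ {M M′ u} → (∀ {w} → M w → M′ w) → InFU M u → InFU M′ u
InFU-mono M⊆M′ (ms , ms≢[] , M-ms , ∪ms) = ms , ms≢[] , All.map M⊆M′ M-ms , ∪ms

module StrictChain (S : ℕ → List (List ℕ))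
                   (S-∝ : ∀ n → S n ∝ S (suc n)) (S-≢ : ∀ n → S n ≢ S (suc n)) where

  ∝-mono : ∀ {m n} → m ≤ n → S m ∝ S n
  ∝-mono = go ∘ ≤⇒≤′
    where
    go : ∀ {m n} → m ≤′ n → S m ∝ S n
    go ≤′-refl = ∝-refl
    go (≤′-step m≤′n) = ∝-trans (go m≤′n) (S-∝ _)

  ∈-mono : ∀ {m n w} → m ≤ n → w ∈ S m → w ∈ S n
  ∈-mono = ∝-∈ ∘ ∝-mono

  ∈-bound : ∀ {ws} → All (λ w → ∃ λ n → w ∈ S n) ws → ∃ λ N → All (_∈ S N) ws
  ∈-bound = common-bound (λ w n → w ∈ S n) ∈-mono

  next : ℕ → List ℕ
  next n = proj₁ (∝-≢⇒∃-next (S-∝ n) (S-≢ n))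

  S-suc : ∀ n → ∃ λ a → S n ++ next n ∷ a ≡ S (suc n)
  S-suc n = proj₂ (∝-≢⇒∃-next (S-∝ n) (S-≢ n))

  next-∈ : ∀ n → next n ∈ S (suc n)
  next-∈ n with a , eq ← S-suc n = subst (next n ∈_) eq (∈-++⁺ʳ (S n) (here refl))

  next-above : ∀ {n w} → IsDC (S (suc n)) → w ∈ S n → w ≺ next n
  next-above {n} (_ , ≺s) w∈ with a , eq ← S-suc n = AllPairs-earlier (S n) (subst (AllPairs _≺_) (sym eq) ≺s) w∈

module ChainLimit (lem : ExcludedMiddle 0ℓ) {F : Family} (dc : ∀ c → F c → IsDC c)
                  (S : ℕ → List (List ℕ)) (F-S : ∀ n → F (S n))
                  (S-∝ : ∀ n → S n ∝ S (suc n)) (S-≢ : ∀ n → S n ≢ S (suc n)) where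

  open StrictChain S S-∝ S-≢

  limit : List ℕ → Bool
  limit u = does (lem {∃ λ n → u ∈ S n})

  limit-true : ∀ u → limit u ≡ true ⇔ ∃ λ n → u ∈ S n
  limit-true u with lem {∃ λ n → u ∈ S n}
  ... | yes ∈S = mk⇔ (λ _ → ∈S) (λ _ → refl)
  ... | no ∉S = mk⇔ (λ ()) (⊥-elim ∘ ∉S)

  eventually-decided : ∀ u → ∃ λ N → limit u ≡ true → u ∈ S N
  eventually-decided u with lem {∃ λ n → u ∈ S n}
  ... | yes (n , u∈) = n , λ _ → u∈
  ... | no _ = 0 , λ ()

  limit-∈-closure : InClosure F limit
  limit-∈-closure us _
    with N , decided ← common-bound (λ u N → limit u ≡ true → u ∈ S N) (λ m≤n → ∈-mono m≤n ∘_)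
                                    (All.tabulate (λ {u} _ → eventually-decided u))
    = S N , F-S N , All.map (λ {u} u∈S → mk⇔ u∈S (λ u∈ → from (limit-true u) (N , u∈))) decided

  S-NEFinSub : ∀ {n w} → w ∈ S n → NEFinSub w
  S-NEFinSub = IsDC-member (dc _ (F-S _))

  ∈-agreeing⇔∈⋃S : ∀ {s w} → (∀ u → FinSub u → Agrees limit s u) → FinSub w → w ∈ s ⇔ ∃ λ n → w ∈ S n
  ∈-agreeing⇔∈⋃S {w = w} agrees fw = ⇔.trans (⇔.sym (agrees w fw)) (limit-true w)

  limit-not-attained : ¬ ∃ λ s → F s × (∀ u → FinSub u → Agrees limit s u)
  limit-not-attained (s , F-s , agrees)
    with N , s⊆S[N] ← ∈-bound (All.tabulate λ w∈s →
                          to (∈-agreeing⇔∈⋃S agrees (proj₁ (IsDC-member (dc s F-s) w∈s))) w∈s)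
    = ≺-irrefl (proj₂ (S-NEFinSub (next-∈ N))) (next-above (dc _ (F-S (suc N))) next∈S[N])
    where
    next∈S[N] : next N ∈ S N
    next∈S[N] =
      All.lookup s⊆S[N] (from (∈-agreeing⇔∈⋃S agrees (proj₁ (S-NEFinSub (next-∈ N)))) (suc N , next-∈ N))

closed⇒¬chain : ExcludedMiddle 0ℓ → ∀ {F} → (∀ c → F c → IsDC c) → PointwiseClosed F → ¬ HasInfChain F
closed⇒¬chain lem dc closed (S , F-S , S-∝ , S-≢) = limit-not-attained (closed limit limit-∈-closure)
  where open ChainLimit lem dc S F-S S-∝ S-≢

module ClosurePoint (lem : ExcludedMiddle 0ℓ) {F : Family} (dc : ∀ c → F c → IsDC c)
                    (tree : IsTree F) {X : List ℕ → Bool} (X∈cl : InClosure F X) where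

  Marked : List ℕ → Set
  Marked u = FinSub u × X u ≡ true

  marked-nonempty : ∀ {u} → Marked u → u ≢ []
  marked-nonempty (fu , Xu) with s , F-s , agrees ∷ [] ← X∈cl [ _ ] (fu ∷ [])
    = proj₂ (IsDC-member (dc s F-s) (to agrees Xu))

  marked-comparable : ∀ {u v} → Marked u → Marked v → u ≡ v ⊎ u ≺ v ⊎ v ≺ u
  marked-comparable (fu , Xu) (fv , Xv)
    with s , F-s , agrees-u ∷ agrees-v ∷ [] ← X∈cl (_ ∷ _ ∷ []) (fu ∷ fv ∷ [])
    = AllPairs-compare (proj₂ (dc s F-s)) (to agrees-u Xu) (to agrees-v Xv)

  record Approximation (t : List (List ℕ)) : Set where
    field
      inF     : F t
      marked  : All Marked t
      initial : ∀ {v} → Marked v → v ∉ t → All (_≺ v) t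

  Outside : List (List ℕ) → List ℕ → Set
  Outside t u = Marked u × u ∉ t

  record LeastOutside (t : List (List ℕ)) (u : List ℕ) : Set where
    field
      u-marked : Marked u
      u∉t      : u ∉ t
      least    : ∀ {w} → Marked w → w ≺ u → w ∈ t

  approximation-[] : Approximation []
  approximation-[] = record { inF = to (tree []) (inj₂ refl) ; marked = [] ; initial = λ _ _ → [] }

  least-outside : ∀ {t v} → Outside t v → ∃ (LeastOutside t)
  least-outside {v = []} (v-marked , _) = ⊥-elim (marked-nonempty v-marked refl)
  least-outside {t} {k ∷ r} v-outside
    with m , (r₀ , u-marked , u∉t) , m-least
           ← least-number lem (λ m → ∃ λ r → Outside t (m ∷ r)) (r , v-outside)
    = m ∷ r₀ , record
      { u-marked = u-marked
      ; u∉t      = u∉t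
      ; least    = λ w-marked w≺u → decidable-stable (_ ∈? t) (not-below w-marked w≺u)
      }
    where
    not-below : ∀ {w} → Marked w → w ≺ (m ∷ r₀) → ¬ w ∉ t
    not-below {[]} w-marked _ _ = marked-nonempty w-marked refl
    not-below {j ∷ q} w-marked ((j<m ∷ _) ∷ _) w∉t = ≤⇒≯ (m-least (q , w-marked , w∉t)) j<m

  agreeing⇒∝ : ∀ {t u s} → Approximation t → LeastOutside t u → F s → Agrees X s u →
               (∀ {w} → FinSub w → w ≺ u → Agrees X s w) → (t ++ [ u ]) ∝ s
  agreeing⇒∝ {t} {u} approx lo F-s agrees-u agrees-below
    with pre , post , refl ← ∈-∃++ (to agrees-u (proj₂ (LeastOutside.u-marked lo)))
    = post , (begin
        (t ++ [ u ]) ++ post  ≡⟨ ++-assoc t [ u ] post ⟩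
        t ++ u ∷ post         ≡⟨ cong (_++ u ∷ post) (sym pre≡t) ⟩
        pre ++ u ∷ post       ∎)
    where
    open ≡-Reasoning
    open Approximation approx
    open LeastOutside lo
    s-dc : IsDC (pre ++ u ∷ post)
    s-dc = dc _ F-s
    pre⊆t : ∀ {w} → w ∈ pre → w ∈ t
    pre⊆t {w} w∈pre = least (fw , from (agrees-below fw w≺u) w∈s) w≺u
      where
      w∈s : w ∈ pre ++ u ∷ post
      w∈s = ∈-++⁺ˡ w∈pre
      w≺u : w ≺ u
      w≺u = AllPairs-earlier pre (proj₂ s-dc) w∈pre
      fw : FinSub w
      fw = proj₁ (IsDC-member s-dc w∈s)
    t⊆pre : ∀ {w} → w ∈ t → w ∈ pre
    t⊆pre w∈t = marked-below⇒∈pre (All.lookup marked w∈t) (All.lookup (initial u-marked u∉t) w∈t)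
      where
      marked-below⇒∈pre : ∀ {w} → Marked w → w ≺ u → w ∈ pre
      marked-below⇒∈pre w-marked@(fw , Xw) w≺u with ∈-++⁻ pre (to (agrees-below fw w≺u) Xw)
      ... | inj₁ w∈pre = w∈pre
      ... | inj₂ (here refl) = ⊥-elim (≺-irrefl (marked-nonempty w-marked) w≺u)
      ... | inj₂ (there w∈post) =
        ⊥-elim (≺-asym (marked-nonempty w-marked) (marked-nonempty u-marked) w≺u
                       (AllPairs-later pre (proj₂ s-dc) w∈post))
    pre≡t : pre ≡ t
    pre≡t = IsDC-≡ (IsDC-++⁻ˡ pre s-dc) (dc t inF) pre⊆t t⊆pre

  -- Every finite set ≺-below u = m ∷ _ is a subset of {1, …, m-1}, so testing X
  -- on the finitely many coordinates u ∷ finSubsBelow m decides all of them.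
  extension-∈F : ∀ {t u} → Approximation t → LeastOutside t u → F (t ++ [ u ])
  extension-∈F {u = []} _ lo = ⊥-elim (marked-nonempty (LeastOutside.u-marked lo) refl)
  extension-∈F {u = u@(m ∷ _)} approx lo
    with s , F-s , agrees-u ∷ agrees-below
           ← X∈cl (u ∷ finSubsBelow m) (proj₁ (LeastOutside.u-marked lo) ∷ finSubsBelow-FinSub m)
    = to (tree _) (inj₁ (s , F-s , agreeing⇒∝ approx lo F-s agrees-u
        (λ fw w≺u → All.lookup agrees-below (finSubsBelow-complete fw (≺⇒<-head w≺u)))))

  extend : ∀ {t u} → Approximation t → LeastOutside t u → Approximation (t ++ [ u ])
  extend {t} {u} approx lo = record
    { inF     = extension-∈F approx lo
    ; marked  = All.∷ʳ⁺ marked u-marked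
    ; initial = λ v-marked v∉ → All.∷ʳ⁺ (initial v-marked (v∉ ∘ ∈-++⁺ˡ)) (u≺later v-marked v∉)
    }
    where
    open Approximation approx
    open LeastOutside lo
    u≺later : ∀ {v} → Marked v → v ∉ t ++ [ u ] → u ≺ v
    u≺later v-marked v∉ with marked-comparable u-marked v-marked
    ... | inj₁ refl = ⊥-elim (v∉ (∈-++⁺ʳ t (here refl)))
    ... | inj₂ (inj₁ u≺v) = u≺v
    ... | inj₂ (inj₂ v≺u) = ⊥-elim (v∉ (∈-++⁺ˡ (least v-marked v≺u)))

  module _ (not-attained : ¬ ∃ λ s → F s × (∀ u → FinSub u → Agrees X s u)) where

    outside : ∀ {t} → Approximation t → ∃ (Outside t)
    outside {t} approx = decidable-stable lem λ none →
      not-attained (t , inF , λ u fu → mk⇔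
        (λ Xu → decidable-stable (u ∈? t) (λ u∉t → none (u , (fu , Xu) , u∉t)))
        (λ u∈t → proj₂ (All.lookup marked u∈t)))
      where open Approximation approx

    approximations : ℕ → Σ (List (List ℕ)) Approximation
    approximations zero = [] , approximation-[]
    approximations (suc n) with t , approx ← approximations n
                            with u , lo ← least-outside (proj₂ (outside approx))
      = t ++ [ u ] , extend approx lo

    chain : HasInfChain F
    chain = proj₁ ∘ approximations , Approximation.inF ∘ proj₂ ∘ approximations
          , (λ n → _ , refl) , λ n → snoc-≢ _

¬chain⇒closed : ExcludedMiddle 0ℓ → ∀ {F} → (∀ c → F c → IsDC c) → IsTree F →
                ¬ HasInfChain F → PointwiseClosed F
¬chain⇒closed lem dc tree no-chain X X∈cl =
  decidable-stable lem (no-chain ∘ ClosurePoint.chain lem dc tree X∈cl)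

hereditary⇒tree : ∀ {F} → (∀ c → F c → IsDC c) → IsHereditary F → IsTree F
hereditary⇒tree {F} dc hereditary t = mk⇔ star⇒F (λ F-t → inj₁ (t , F-t , ∝-refl))
  where
  star⇒F : Star F t → F t
  star⇒F (inj₂ refl) = to (hereditary []) (inj₂ refl)
  star⇒F (inj₁ (s , F-s , t∝s@(_ , refl))) =
    to (hereditary t) (inj₁ (IsDC-++⁻ˡ t (dc s F-s) , s , F-s , All.tabulate (∈⇒InFU ∘ ∝-∈ t∝s)))

chain⇒B-subset : ∀ {F} → (∀ c → F c → IsDC c) → IsHereditary F → HasInfChain F →
                 ∃ λ (D : ℕ → List ℕ) → IsInfDC D × BSubset D F
chain⇒B-subset {F} dc hereditary (S , F-S , S-∝ , S-≢) = next , (next-nonempty , next-≺) , B⊆F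
  where
  open StrictChain S S-∝ S-≢
  next-nonempty : ∀ n → NEFinSub (next n)
  next-nonempty n = IsDC-member (dc _ (F-S (suc n))) (next-∈ n)
  next-≺ : ∀ n → next n ≺ next (suc n)
  next-≺ n = next-above (dc _ (F-S (suc (suc n)))) (next-∈ n)
  eventually-InFU : ∀ {u} → InFU (MemSeq next) u → ∃ λ N → InFU (_∈ S N) u
  eventually-InFU (ms , ms≢[] , ms-next , ∪ms)
    with N , ms∈S ← ∈-bound (All.map (λ { (n , refl) → suc n , next-∈ n }) ms-next)
    = N , ms , ms≢[] , ms∈S , ∪ms
  B⊆F : BSubset next F
  B⊆F t t-dc t-FU
    with N , t-FU-S ← common-bound (λ u N → InFU (_∈ S N) u) (λ m≤n → InFU-mono (∈-mono m≤n))
                                   (All.map eventually-InFU t-FU)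
    = to (hereditary t) (inj₁ (t-dc , S N , F-S N , t-FU-S))

initialSegment : (ℕ → List ℕ) → ℕ → List (List ℕ)
initialSegment D zero = []
initialSegment D (suc n) = initialSegment D n ++ [ D n ]

initialSegment-IsDC : ∀ {D} → IsInfDC D → ∀ n → IsDC (initialSegment D n) × All (_≺ D n) (initialSegment D n)
initialSegment-IsDC _ zero = ([] , []) , []
initialSegment-IsDC D-dc@(D-ne , D-≺) (suc n) with (ne , ≺s) , ≺Dn ← initialSegment-IsDC D-dc n =
  (All.∷ʳ⁺ ne (D-ne n) , AllPairs.++⁺ ≺s ([] ∷ []) (All.map (_∷ []) ≺Dn)) ,
  All.∷ʳ⁺ (All.map (λ w≺Dn → ≺-trans (proj₂ (D-ne n)) w≺Dn (D-≺ n)) ≺Dn) (D-≺ n)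

initialSegment-InFU : ∀ D n → All (InFU (MemSeq D)) (initialSegment D n)
initialSegment-InFU D zero = []
initialSegment-InFU D (suc n) = All.∷ʳ⁺ (initialSegment-InFU D n) (∈⇒InFU (n , refl))

B-subset⇒chain : ∀ {F D} → IsInfDC D → BSubset D F → HasInfChain F
B-subset⇒chain {D = D} D-dc B⊆F =
  initialSegment D , (λ n → B⊆F _ (proj₁ (initialSegment-IsDC D-dc n)) (initialSegment-InFU D n))
  , (λ n → [ D n ] , refl) , (λ n → snoc-≢ (initialSegment D n))

proposition2p5 : ExcludedMiddle 0ℓ → (F : Family) → (∀ c → F c → IsDC c) →
    (IsTree F → (PointwiseClosed F ⇔ (¬ HasInfChain F)))
    × (IsHereditary F → (PointwiseClosed F ⇔ (¬ (∃ λ (D : ℕ → List ℕ) → IsInfDC D × BSubset D F))))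
proposition2p5 lem F dc =
  (λ tree → mk⇔ (closed⇒¬chain lem dc) (¬chain⇒closed lem dc tree)) ,
  (λ hereditary → mk⇔
    (λ closed (_ , D-dc , B⊆F) → closed⇒¬chain lem dc closed (B-subset⇒chain D-dc B⊆F))
    (λ no-D → ¬chain⇒closed lem dc (hereditary⇒tree dc hereditary) (no-D ∘ chain⇒B-subset dc hereditary)))
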